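{- For $p \in \mathbb{N}_0$ and $n\in\mathbb{N}_0$, $$\sum_{k=1}^n k^2 H_{p+k}^{(2)} = \frac{p(p+1)(2p+1) + n(n+1)(2n+1)}{6} H_{p+n}^{(2)} - \frac{p(p+1)(2p+1)}{6} H_p^{(2)} - \frac{6p^2 + 6p + 1}{6} (H_{p+n} - H_p) + \frac{(4p+2-n)n}{6}.$$
   Context: Generalized harmonic numbers: for $l,m\in\mathbb{N}_0$, $H_0^{(l)}=0$ and $H_m^{(l)}=\sum_{k=1}^m \frac{1}{k^l}$ for $m\ge1$; $H_m=H_m^{(1)}$. -}

module Defs where

open import Data.Nat as ℕ using (ℕ; zero; suc)
open import Data.Nat.Properties using (m^n≢0)
open import Data.Integer using (+_)
open import Data.Rational using (ℚ; _+_; _/_; 0ℚ)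

H : ℕ → ℕ → ℚ
H l zero = 0ℚ
H l (suc m) = H l m + _/_ (+ 1) (suc m ℕ.^ l) {{m^n≢0 (suc m) l}}

H₁ : ℕ → ℚ
H₁ = H 1

Σ₁ : ℕ → (ℕ → ℚ) → ℚ
Σ₁ zero f = 0ℚ
Σ₁ (suc n) f = Σ₁ n f + f (suc n)

module Submission where

-- Write P, N for p, n viewed as rationals and C(x) = x(x+1)(2x+1) = 6 Σ_{k≤x} k².
-- The right-hand side is a polynomial F(P, N, H^{(2)}_{p+n}, H_{p+n}, H^{(2)}_p, H_p)
-- in which the harmonic numbers occur as independent indeterminates.  Going from n to
-- n+1 replaces H^{(2)}_{p+n} by H^{(2)}_{p+n} + q and H_{p+n} by H_{p+n} + Mq, where
-- M = p+n+1 and q = 1/M².  A single polynomial identity shows that F then grows by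
-- (n+1)²·(H^{(2)}_{p+n} + q) plus the error term (4P+1-2N)(1 - M²q)/6, which vanishes
-- because M²q = 1.  Together with F(P, 0, h, g, h, g) = 0 this is the induction.

open import Defs
open import Data.Nat as ℕ using (ℕ; zero; suc)
open import Data.Nat.Properties using (+-suc) renaming (+-identityʳ to ℕ-+-identityʳ)
open import Data.Integer using (ℤ; +_)
import Data.Integer as ℤ
import Data.Integer.Properties as ℤₚ
open import Data.Rational using (ℚ; _+_; _-_; _*_; _/_; -_; 0ℚ; 1ℚ; toℚᵘ)
open import Data.Rational.Properties
  using (toℚᵘ-injective; toℚᵘ-fromℚᵘ; toℚᵘ-homo-+; toℚᵘ-homo-*; toℚᵘ-homo‿-;
         +-inverseʳ; +-identityʳ; *-zeroʳ; *-identityʳ; *-identityˡ; *-comm)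
import Data.Rational.Unnormalised as U
open import Data.Rational.Unnormalised.Properties using (+-cong; *-cong; -‿cong; module ≃-Reasoning)
open import Data.Rational.Solver using (module +-*-Solver)
open import Relation.Binary.PropositionalEquality
  using (_≡_; refl; sym; trans; cong; cong₂; subst; module ≡-Reasoning)

-- The embeddings ℤ → ℚ and ℕ → ℚ, written exactly as the statement writes them.
ιℤ : ℤ → ℚ
ιℤ i = i / 1

ι : ℕ → ℚ
ι k = + k / 1

-- Arithmetic facts about i / d, checked on unnormalised rationals: toℚᵘ is injective
-- and additive/multiplicative, and unnormalised fractions are compared by plain
-- cross-multiplication of integers.
module _ where
  open ≃-Reasoning

  toℚᵘ-/ : ∀ i k → toℚᵘ (i / suc k) U.≃ U.mkℚᵘ i k
  toℚᵘ-/ i k = toℚᵘ-fromℚᵘ (U.mkℚᵘ i k)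

  ιℤ-+ : ∀ a b → ιℤ (a ℤ.+ b) ≡ ιℤ a + ιℤ b
  ιℤ-+ a b = toℚᵘ-injective (begin
    toℚᵘ (ιℤ (a ℤ.+ b))           ≈⟨ toℚᵘ-/ (a ℤ.+ b) 0 ⟩
    U.mkℚᵘ (a ℤ.+ b) 0             ≈⟨ U.*≡* (cong (ℤ._* + 1) (sym (cong₂ ℤ._+_ (ℤₚ.*-identityʳ a) (ℤₚ.*-identityʳ b)))) ⟩
    U.mkℚᵘ a 0 U.+ U.mkℚᵘ b 0       ≈⟨ +-cong (toℚᵘ-/ a 0) (toℚᵘ-/ b 0) ⟨
    toℚᵘ (ιℤ a) U.+ toℚᵘ (ιℤ b)     ≈⟨ toℚᵘ-homo-+ (ιℤ a) (ιℤ b) ⟨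
    toℚᵘ (ιℤ a + ιℤ b)             ∎)

  ιℤ-* : ∀ a b → ιℤ (a ℤ.* b) ≡ ιℤ a * ιℤ b
  ιℤ-* a b = toℚᵘ-injective (begin
    toℚᵘ (ιℤ (a ℤ.* b))           ≈⟨ toℚᵘ-/ (a ℤ.* b) 0 ⟩
    U.mkℚᵘ a 0 U.* U.mkℚᵘ b 0       ≈⟨ *-cong (toℚᵘ-/ a 0) (toℚᵘ-/ b 0) ⟨
    toℚᵘ (ιℤ a) U.* toℚᵘ (ιℤ b)     ≈⟨ toℚᵘ-homo-* (ιℤ a) (ιℤ b) ⟨
    toℚᵘ (ιℤ a * ιℤ b)             ∎)

  ιℤ-neg : ∀ a → ιℤ (ℤ.- a) ≡ - ιℤ a
  ιℤ-neg a = toℚᵘ-injective (begin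
    toℚᵘ (ιℤ (ℤ.- a))             ≈⟨ toℚᵘ-/ (ℤ.- a) 0 ⟩
    U.- U.mkℚᵘ a 0                 ≈⟨ -‿cong (toℚᵘ-/ a 0) ⟨
    U.- toℚᵘ (ιℤ a)                ≈⟨ toℚᵘ-homo‿- (ιℤ a) ⟨
    toℚᵘ (- ιℤ a)                  ∎)

  /-as-* : ∀ i k → i / suc k ≡ ιℤ i * (+ 1 / suc k)
  /-as-* i k = toℚᵘ-injective (begin
    toℚᵘ (i / suc k)                      ≈⟨ toℚᵘ-/ i k ⟩
    U.mkℚᵘ i k                             ≈⟨ U.*≡* (trans (cong (i ℤ.*_) (ℤₚ.*-identityˡ (+ suc k))) (cong (ℤ._* + suc k) (sym (ℤₚ.*-identityʳ i)))) ⟩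
    U.mkℚᵘ i 0 U.* U.mkℚᵘ (+ 1) k           ≈⟨ *-cong (toℚᵘ-/ i 0) (toℚᵘ-/ (+ 1) k) ⟨
    toℚᵘ (ιℤ i) U.* toℚᵘ (+ 1 / suc k)      ≈⟨ toℚᵘ-homo-* (ιℤ i) (+ 1 / suc k) ⟨
    toℚᵘ (ιℤ i * (+ 1 / suc k))            ∎)

  reciprocal-inverse : ∀ d .{{_ : ℕ.NonZero d}} → (+ 1 / d) * ι d ≡ 1ℚ
  reciprocal-inverse (suc k) = toℚᵘ-injective (begin
    toℚᵘ ((+ 1 / suc k) * ι (suc k))            ≈⟨ toℚᵘ-homo-* (+ 1 / suc k) (ι (suc k)) ⟩
    toℚᵘ (+ 1 / suc k) U.* toℚᵘ (ι (suc k))     ≈⟨ *-cong (toℚᵘ-/ (+ 1) k) (toℚᵘ-/ (+ suc k) 0) ⟩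
    U.mkℚᵘ (+ 1) k U.* U.mkℚᵘ (+ suc k) 0        ≈⟨ U.*≡* (ℤₚ.*-assoc (+ 1) (+ suc k) (+ 1)) ⟩
    U.1ℚᵘ                                        ∎)

ι-+ : ∀ a b → ι (a ℕ.+ b) ≡ ι a + ι b
ι-+ a b = trans (cong ιℤ (ℤₚ.pos-+ a b)) (ιℤ-+ (+ a) (+ b))

ι-* : ∀ a b → ι (a ℕ.* b) ≡ ι a * ι b
ι-* a b = trans (cong ιℤ (ℤₚ.pos-* a b)) (ιℤ-* (+ a) (+ b))

ιℤ-- : ∀ a b → ιℤ (a ℤ.- b) ≡ ιℤ a - ιℤ b
ιℤ-- a b = trans (ιℤ-+ a (ℤ.- b)) (cong (λ x → ιℤ a + x) (ιℤ-neg b))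

ι-suc : ∀ k → ι (suc k) ≡ 1ℚ + ι k
ι-suc = ι-+ 1

⅙ : ℚ
⅙ = + 1 / 6

-- Instantiated both by ℚ itself
-- and by the solver's polynomial syntax, so that the closed form is defined only once
-- and solver identities about it are definitionally identities about rationals.
record RingSyntax (A : Set) : Set where
  infixl 6 _⊕_ _⊖_
  infixl 7 _⊗_
  field
    _⊕_ _⊗_ _⊖_ : A → A → A
    κ           : ℚ → A

module ClosedForm {A : Set} (R : RingSyntax A) where
  open RingSyntax R

  -- x(x+1)(2x+1), six times the sum of the first x squares.
  sixSquares : A → A
  sixSquares x = x ⊗ (x ⊕ κ 1ℚ) ⊗ (κ (ι 2) ⊗ x ⊕ κ 1ℚ)

  -- The right-hand side of the theorem, with P = p, N = n, h = H^{(2)}_{p+n},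
  -- g = H_{p+n}, hP = H^{(2)}_p and gP = H_p as independent indeterminates.
  closedForm : (P N h g hP gP : A) → A
  closedForm P N h g hP gP =
    ((sixSquares P ⊕ sixSquares N) ⊗ κ ⅙) ⊗ h
    ⊖ (sixSquares P ⊗ κ ⅙) ⊗ hP
    ⊖ ((κ (ι 6) ⊗ P ⊗ P ⊕ κ (ι 6) ⊗ P ⊕ κ 1ℚ) ⊗ κ ⅙) ⊗ (g ⊖ gP)
    ⊕ ((κ (ι 4) ⊗ P ⊕ κ (ι 2) ⊖ N) ⊗ N) ⊗ κ ⅙

ℚ-syntax : RingSyntax ℚ
ℚ-syntax = record { _⊕_ = _+_ ; _⊗_ = _*_ ; _⊖_ = _-_ ; κ = λ c → c }

open ClosedForm ℚ-syntax public

module _ {n : ℕ} where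
  open +-*-Solver
  polynomial-syntax : RingSyntax (Polynomial n)
  polynomial-syntax = record { _⊕_ = _:+_ ; _⊗_ = _:*_ ; _⊖_ = _:-_ ; κ = con }

module Syntactic {n : ℕ} = ClosedForm (polynomial-syntax {n})

closedForm-base : ∀ P h g → closedForm P 0ℚ h g h g ≡ 0ℚ
closedForm-base = solve 3 (λ P h g → Syntactic.closedForm P (con 0ℚ) h g h g := con 0ℚ) refl
  where open +-*-Solver

closedForm-step-identity : ∀ P N h g hP gP q →
  closedForm P (1ℚ + N) (h + q) (g + (1ℚ + (P + N)) * q) hP gP
    ≡ closedForm P N h g hP gP + (1ℚ + N) * (1ℚ + N) * (h + q)
      + ⅙ * (ι 4 * P + 1ℚ - ι 2 * N) * (1ℚ - (1ℚ + (P + N)) * (1ℚ + (P + N)) * q)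
closedForm-step-identity = solve 7 (λ P N h g hP gP q →
  Syntactic.closedForm P (con 1ℚ :+ N) (h :+ q) (g :+ (con 1ℚ :+ (P :+ N)) :* q) hP gP
    := Syntactic.closedForm P N h g hP gP :+ (con 1ℚ :+ N) :* (con 1ℚ :+ N) :* (h :+ q)
      :+ con ⅙ :* (con (ι 4) :* P :+ con 1ℚ :- con (ι 2) :* N) :* (con 1ℚ :- (con 1ℚ :+ (P :+ N)) :* (con 1ℚ :+ (P :+ N)) :* q)) refl
  where open +-*-Solver

closedForm-step : ∀ P N h g hP gP q → (1ℚ + (P + N)) * (1ℚ + (P + N)) * q ≡ 1ℚ →
  closedForm P (1ℚ + N) (h + q) (g + (1ℚ + (P + N)) * q) hP gP
    ≡ closedForm P N h g hP gP + (1ℚ + N) * (1ℚ + N) * (h + q)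
closedForm-step P N h g hP gP q M²q≡1 = begin
  closedForm P (1ℚ + N) (h + q) (g + M * q) hP gP      ≡⟨ closedForm-step-identity P N h g hP gP q ⟩
  increment + correction * (1ℚ - M * M * q)           ≡⟨ cong (λ u → increment + correction * (1ℚ - u)) M²q≡1 ⟩
  increment + correction * (1ℚ - 1ℚ)                  ≡⟨ cong (λ u → increment + correction * u) (+-inverseʳ 1ℚ) ⟩
  increment + correction * 0ℚ                         ≡⟨ cong (λ x → increment + x) (*-zeroʳ correction) ⟩
  increment + 0ℚ                                      ≡⟨ +-identityʳ increment ⟩
  increment                                           ∎
  where
  open ≡-Reasoning
  M increment correction : ℚ
  M = 1ℚ + (P + N)
  increment = closedForm P N h g hP gP + (1ℚ + N) * (1ℚ + N) * (h + q)
  correction = ⅙ * (ι 4 * P + 1ℚ - ι 2 * N)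

reciprocal-from-square : ∀ M s q → s * M ≡ 1ℚ → M * M * q ≡ 1ℚ → s ≡ M * q
reciprocal-from-square M s q sM≡1 M²q≡1 = begin
  s                    ≡⟨ *-identityʳ s ⟨
  s * 1ℚ               ≡⟨ cong (s *_) M²q≡1 ⟨
  s * (M * M * q)      ≡⟨ solve 3 (λ M s q → s :* (M :* M :* q) := (s :* M) :* (M :* q)) refl M s q ⟩
  (s * M) * (M * q)    ≡⟨ cong (_* (M * q)) sM≡1 ⟩
  1ℚ * (M * q)         ≡⟨ *-identityˡ (M * q) ⟩
  M * q                ∎
  where open ≡-Reasoning
        open +-*-Solver

module HarmonicIncrement (m : ℕ) where
  M q : ℚ
  M = ι (suc m)
  q = + 1 / (suc m ℕ.^ 2)

  square-reciprocal : M * M * q ≡ 1ℚ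
  square-reciprocal = begin
    M * M * q               ≡⟨ *-comm (M * M) q ⟩
    q * (M * M)             ≡⟨ cong (λ x → q * (M * x)) (*-identityʳ M) ⟨
    q * (M * (M * 1ℚ))      ≡⟨ cong (q *_) (trans (ι-* (suc m) (suc m ℕ.* 1)) (cong (M *_) (ι-* (suc m) 1))) ⟨
    q * ι (suc m ℕ.^ 2)     ≡⟨ reciprocal-inverse (suc m ℕ.^ 2) ⟩
    1ℚ                      ∎
    where open ≡-Reasoning

  reciprocal-via-square : + 1 / (suc m ℕ.^ 1) ≡ M * q
  reciprocal-via-square = reciprocal-from-square M (+ 1 / (suc m ℕ.^ 1)) q
    (trans (cong (λ x → + 1 / (suc m ℕ.^ 1) * x) (sym (trans (ι-* (suc m) 1) (*-identityʳ M))))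
           (reciprocal-inverse (suc m ℕ.^ 1)))
    square-reciprocal

sum-closedForm : ∀ p n →
  Σ₁ n (λ k → ι (k ℕ.* k) * H 2 (p ℕ.+ k))
    ≡ closedForm (ι p) (ι n) (H 2 (p ℕ.+ n)) (H₁ (p ℕ.+ n)) (H 2 p) (H₁ p)
sum-closedForm p zero rewrite ℕ-+-identityʳ p = sym (closedForm-base (ι p) (H 2 p) (H₁ p))
sum-closedForm p (suc n) rewrite +-suc p n = begin
  Σ₁ n summand + ι (suc n ℕ.* suc n) * (h + q)
    ≡⟨ cong₂ (λ x y → x + y * (h + q)) (sum-closedForm p n) (trans (ι-* (suc n) (suc n)) (cong₂ _*_ (ι-suc n) (ι-suc n))) ⟩
  closedForm P N h g hP gP + (1ℚ + N) * (1ℚ + N) * (h + q)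
    ≡⟨ closedForm-step P N h g hP gP q M²q≡1 ⟨
  closedForm P (1ℚ + N) (h + q) (g + (1ℚ + (P + N)) * q) hP gP
    ≡⟨ cong₂ (λ x y → closedForm P x (h + q) (g + y) hP gP) (sym (ι-suc n)) (sym Mq≡s) ⟩
  closedForm P (ι (suc n)) (h + q) (g + + 1 / (suc (p ℕ.+ n) ℕ.^ 1)) hP gP
    ∎
  where
  open ≡-Reasoning
  open HarmonicIncrement (p ℕ.+ n)
  summand : ℕ → ℚ
  summand k = ι (k ℕ.* k) * H 2 (p ℕ.+ k)
  P N h g hP gP : ℚ
  P = ι p
  N = ι n
  h = H 2 (p ℕ.+ n)
  g = H₁ (p ℕ.+ n)
  hP = H 2 p
  gP = H₁ p
  M-split : M ≡ 1ℚ + (P + N)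
  M-split = trans (ι-suc (p ℕ.+ n)) (cong (λ x → 1ℚ + x) (ι-+ p n))
  M²q≡1 : (1ℚ + (P + N)) * (1ℚ + (P + N)) * q ≡ 1ℚ
  M²q≡1 = subst (λ x → x * x * q ≡ 1ℚ) M-split square-reciprocal
  Mq≡s : + 1 / (suc (p ℕ.+ n) ℕ.^ 1) ≡ (1ℚ + (P + N)) * q
  Mq≡s = subst (λ x → + 1 / (suc (p ℕ.+ n) ℕ.^ 1) ≡ x * q) M-split reciprocal-via-square

ι-sixSquares : ∀ x → ι (x ℕ.* (x ℕ.+ 1) ℕ.* (2 ℕ.* x ℕ.+ 1)) ≡ sixSquares (ι x)
ι-sixSquares x = begin
  ι (x ℕ.* (x ℕ.+ 1) ℕ.* (2 ℕ.* x ℕ.+ 1))       ≡⟨ ι-* (x ℕ.* (x ℕ.+ 1)) (2 ℕ.* x ℕ.+ 1) ⟩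
  ι (x ℕ.* (x ℕ.+ 1)) * ι (2 ℕ.* x ℕ.+ 1)        ≡⟨ cong₂ _*_ (ι-* x (x ℕ.+ 1)) (ι-+ (2 ℕ.* x) 1) ⟩
  ι x * ι (x ℕ.+ 1) * (ι (2 ℕ.* x) + 1ℚ)         ≡⟨ cong₂ (λ y z → ι x * y * (z + 1ℚ)) (ι-+ x 1) (ι-* 2 x) ⟩
  sixSquares (ι x)                               ∎
  where open ≡-Reasoning

ι-quadratic : ∀ p → ι (6 ℕ.* p ℕ.* p ℕ.+ 6 ℕ.* p ℕ.+ 1) ≡ ι 6 * ι p * ι p + ι 6 * ι p + 1ℚ
ι-quadratic p = begin
  ι (6 ℕ.* p ℕ.* p ℕ.+ 6 ℕ.* p ℕ.+ 1)          ≡⟨ ι-+ (6 ℕ.* p ℕ.* p ℕ.+ 6 ℕ.* p) 1 ⟩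
  ι (6 ℕ.* p ℕ.* p ℕ.+ 6 ℕ.* p) + 1ℚ            ≡⟨ cong (_+ 1ℚ) (ι-+ (6 ℕ.* p ℕ.* p) (6 ℕ.* p)) ⟩
  ι (6 ℕ.* p ℕ.* p) + ι (6 ℕ.* p) + 1ℚ          ≡⟨ cong₂ (λ y z → y + z + 1ℚ) (trans (ι-* (6 ℕ.* p) p) (cong (_* ι p) (ι-* 6 p))) (ι-* 6 p) ⟩
  ι 6 * ι p * ι p + ι 6 * ι p + 1ℚ              ∎
  where open ≡-Reasoning

ιℤ-linear : ∀ p n → ιℤ ((+ (4 ℕ.* p ℕ.+ 2) ℤ.- + n) ℤ.* + n) ≡ (ι 4 * ι p + ι 2 - ι n) * ι n
ιℤ-linear p n = begin
  ιℤ ((+ (4 ℕ.* p ℕ.+ 2) ℤ.- + n) ℤ.* + n)      ≡⟨ ιℤ-* (+ (4 ℕ.* p ℕ.+ 2) ℤ.- + n) (+ n) ⟩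
  ιℤ (+ (4 ℕ.* p ℕ.+ 2) ℤ.- + n) * ι n          ≡⟨ cong (_* ι n) (ιℤ-- (+ (4 ℕ.* p ℕ.+ 2)) (+ n)) ⟩
  (ι (4 ℕ.* p ℕ.+ 2) - ι n) * ι n               ≡⟨ cong (λ y → (y - ι n) * ι n) (trans (ι-+ (4 ℕ.* p) 2) (cong (_+ ι 2) (ι-* 4 p))) ⟩
  (ι 4 * ι p + ι 2 - ι n) * ι n                 ∎
  where open ≡-Reasoning

sixth : ∀ i → i / 6 ≡ ιℤ i * ⅙
sixth i = /-as-* i 5

closedForm-matches : ∀ p n →
  closedForm (ι p) (ι n) (H 2 (p ℕ.+ n)) (H₁ (p ℕ.+ n)) (H 2 p) (H₁ p)
    ≡ ((+ (p ℕ.* (p ℕ.+ 1) ℕ.* (2 ℕ.* p ℕ.+ 1) ℕ.+ n ℕ.* (n ℕ.+ 1) ℕ.* (2 ℕ.* n ℕ.+ 1))) / 6) * H 2 (p ℕ.+ n)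
      - ((+ (p ℕ.* (p ℕ.+ 1) ℕ.* (2 ℕ.* p ℕ.+ 1))) / 6) * H 2 p
      - ((+ (6 ℕ.* p ℕ.* p ℕ.+ 6 ℕ.* p ℕ.+ 1)) / 6) * (H₁ (p ℕ.+ n) - H₁ p)
      + ((+ (4 ℕ.* p ℕ.+ 2) Data.Integer.- + n) Data.Integer.* + n) / 6
closedForm-matches p n = sym (cong₄ (λ a b c d → a * H 2 (p ℕ.+ n) - b * H 2 p - c * (H₁ (p ℕ.+ n) - H₁ p) + d)
  (trans (sixth (+ (sixSquaresℕ p ℕ.+ sixSquaresℕ n)))
         (cong (_* ⅙) (trans (ι-+ (sixSquaresℕ p) (sixSquaresℕ n)) (cong₂ _+_ (ι-sixSquares p) (ι-sixSquares n)))))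
  (trans (sixth (+ sixSquaresℕ p)) (cong (_* ⅙) (ι-sixSquares p)))
  (trans (sixth (+ (6 ℕ.* p ℕ.* p ℕ.+ 6 ℕ.* p ℕ.+ 1))) (cong (_* ⅙) (ι-quadratic p)))
  (trans (sixth ((+ (4 ℕ.* p ℕ.+ 2) ℤ.- + n) ℤ.* + n)) (cong (_* ⅙) (ιℤ-linear p n))))
  where
  sixSquaresℕ : ℕ → ℕ
  sixSquaresℕ x = x ℕ.* (x ℕ.+ 1) ℕ.* (2 ℕ.* x ℕ.+ 1)
  cong₄ : ∀ {a b c d a′ b′ c′ d′ : ℚ} (f : ℚ → ℚ → ℚ → ℚ → ℚ) →
    a ≡ a′ → b ≡ b′ → c ≡ c′ → d ≡ d′ → f a b c d ≡ f a′ b′ c′ d′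
  cong₄ f refl refl refl refl = refl

corollary10 : (p n : ℕ) →
    Σ₁ n (λ k → ((+ (k ℕ.* k)) / 1) * H 2 (p ℕ.+ k))
      ≡ ((+ (p ℕ.* (p ℕ.+ 1) ℕ.* (2 ℕ.* p ℕ.+ 1) ℕ.+ n ℕ.* (n ℕ.+ 1) ℕ.* (2 ℕ.* n ℕ.+ 1))) / 6) * H 2 (p ℕ.+ n)
        - ((+ (p ℕ.* (p ℕ.+ 1) ℕ.* (2 ℕ.* p ℕ.+ 1))) / 6) * H 2 p
        - ((+ (6 ℕ.* p ℕ.* p ℕ.+ 6 ℕ.* p ℕ.+ 1)) / 6) * (H₁ (p ℕ.+ n) - H₁ p)
        + ((+ (4 ℕ.* p ℕ.+ 2) Data.Integer.- + n) Data.Integer.* + n) / 6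
corollary10 p n = trans (sum-closedForm p n) (closedForm-matches p n)
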